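{- Let $a,h,d,b$ be positive integers with $b\ge4$ and $\gcd(a,d)=1$, and let $A(a)=(a,ha+d,ha+2d,ha+bd,ha+(b+1)d,ha+2bd)$. Write $Q=\left\lfloor\frac{a}{2b}\right\rfloor$. If $b$ is even, $h\ge\left\lceil\frac{2d}{b-2}\right\rceil$ and $a\ge b(b-2)$, then $$g(A(a))=\begin{cases}(Q+\tfrac b2-1)ha+2bdQ-a-d & \text{if } a\equiv 0,1,\dots,b-3\pmod{2b},\\ (Q+\tfrac b2-1)ha+2bdQ-a+bd-3d & \text{if } a\equiv b-2\pmod{2b},\\ (Q+\tfrac b2-1)ha+2bdQ-a+bd-2d & \text{if } a\equiv b-1\pmod{2b},\\ (Q+\tfrac b2)ha+2bdQ-a+bd-d & \text{if } a\equiv b,b+1,\dots,2b-2\pmod{2b},\\ (Q+\tfrac b2)ha+2bdQ-a+2bd-2d & \text{if } a\equiv 2b-1\pmod{2b}.\end{cases}$$ If $b$ is odd, $h\ge\left\lceil\frac{2d}{b-1}\right\rceil$ and $a\ge b(b-1)$, then $$g(A(a))=\begin{cases}(Q+\tfrac{b-1}2)ha+2bdQ-a-d & \text{if } a\equiv 0,1,\dots,b-2\pmod{2b},\\ (Q+\tfrac{b-1}2)ha+2bdQ-a+bd-2d & \text{if } a\equiv b-1\pmod{2b},\\ (Q+\tfrac{b-1}2)ha+2bdQ-a+bd-d & \text{if } a\equiv b,b+1,\dots,2b-3\pmod{2b},\\ (Q+\tfrac{b-1}2)ha+2bdQ-a+2bd-3d & \text{if } a\equiv 2b-2\pmod{2b},\\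 (Q+\tfrac{b-1}2)ha+2bdQ-a+2bd-2d & \text{if } a\equiv 2b-1\pmod{2b}.\end{cases}$$
   Context: For positive integers $a_1,\dots,a_n$ with $\gcd=1$, the Frobenius number $g(a_1,\dots,a_n)$ is the largest integer not representable as $\sum x_ia_i$ with nonnegative integers $x_i$. -}

module Defs where

open import Data.Nat using (ℕ; zero; suc; _+_; _*_; _∸_; _/_; _%_)
open import Data.Integer using (ℤ; +_; _>_)
open import Data.Vec using (Vec; []; _∷_; zipWith; sum)
open import Data.Product using (∃; _×_)
open import Relation.Binary.PropositionalEquality using (_≡_)
open import Relation.Nullary using (¬_)

Representable : {n : ℕ} → Vec ℕ n → ℕ → Set
Representable {n} as m = ∃ λ (xs : Vec ℕ n) → sum (zipWith _*_ xs as) ≡ m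

Representableℤ : {n : ℕ} → Vec ℕ n → ℤ → Set
Representableℤ as z = ∃ λ (m : ℕ) → (z ≡ + m) × Representable as m

IsFrobeniusNumber : {n : ℕ} → Vec ℕ n → ℤ → Set
IsFrobeniusNumber as g =
  ¬ Representableℤ as g × (∀ (z : ℤ) → z > g → Representableℤ as z)

-- ceiling division ⌈ m / n ⌉ (convention: 0 when n = 0, never used here)
⌈_/_⌉ : ℕ → ℕ → ℕ
⌈ m / zero ⌉ = 0
⌈ m / suc k ⌉ = (m + k) / suc k

A : (a h d b : ℕ) → Vec ℕ 6
A a h d b =
  a ∷ h * a + d ∷ h * a + 2 * d ∷ h * a + b * d ∷ h * a + (b + 1) * d
    ∷ h * a + 2 * b * d ∷ []

-- floor division / remainder with divisor given as a variable
-- (convention: 0 / m when divisor is 0; never used here since 2b ≥ 8)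
⌊_/_⌋ : ℕ → ℕ → ℕ
⌊ m / zero ⌋ = 0
⌊ m / suc k ⌋ = m / suc k

_mod_ : ℕ → ℕ → ℕ
m mod zero = m
m mod suc k = m % suc k

-- Every element of the semigroup is x₀a + Σ yᵢ(ha + eᵢd) with eᵢ ∈ {1, 2, b, b+1, 2b}, that is
-- x₀a + c·h·a + W·d, where c = Σ yᵢ counts the generators used and W = Σ yᵢeᵢ is their weight.
-- Since gcd(a, d) = 1, the residue class of an element modulo a is fixed by W mod a, so the
-- Frobenius number is max_{S<a} m(S) − a, where m(S) is the least c·h·a + W·d with W ≡ S (mod a)
-- (Brauer–Shockley). A weight bK + E with E < b needs at least ⌈(K + E)/2⌉ generators and is
-- reached with that many. In each of the ten cases for a mod 2b we exhibit the maximising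
-- S = b·Ks + Es, either a − 1 or the largest S < a with last digit b − 1, and check that every
-- other residue below a is reached no more expensively: the bound on h handles the few residues
-- above S, while a ≥ b(b − 2), resp. b(b − 1), keeps weights W ≥ S + a from being cheaper than S.

module Submission where

open import Defs

module Frobenius where
  open import Data.Nat
  open import Data.Nat.Properties
  open import Data.Nat.Divisibility using (_∣_; ∣⇒≤; ∣m+n∣m⇒∣n; n∣m*n)
  open import Data.Nat.DivMod using (m≡m%n+[m/n]*n; m%n<n; m*n/n≡m; /-monoˡ-≤)
  open import Data.Nat.GCD using (gcd; module Bézout)
  open import Data.Nat.Coprimality using (gcd≡1⇒coprime; coprime-divisor; coprime-Bézout)
  open import Data.Nat.Tactic.RingSolver using (solve)
  open import Data.Integer.Base as ℤ using (_⊖_)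
  import Data.Integer.Properties as ℤₚ
  open import Data.List.Base using (List; []; _∷_)
  open import Data.Vec.Base as Vec using (Vec)
  open import Data.Product.Base using (∃-syntax; ∃₂; _×_; _,_)
  open import Data.Sum.Base using (_⊎_; inj₁; inj₂)
  import Data.Sum.Base as Sum
  open import Data.Empty using (⊥)
  open import Relation.Nullary using (¬_; yes; no; contradiction)
  open import Function.Base using (_$_)
  open import Relation.Binary.PropositionalEquality
  open ≤-Reasoning

  m+o≡n⇒m≤n : ∀ {m n} o → m + o ≡ n → m ≤ n
  m+o≡n⇒m≤n {m} o refl = m≤m+n m o

  half-≤ : ∀ {m n} → 2 * m ≤ 2 * n + 1 → m ≤ n
  half-≤ {m} {n} 2m≤2n+1 = m<1+n⇒m≤n (*-cancelˡ-< 2 m (suc n) (begin-strict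
    2 * m            ≤⟨ 2m≤2n+1 ⟩
    2 * n + 1        <⟨ n<1+n (2 * n + 1) ⟩
    suc (2 * n + 1)  ≡⟨ solve (n ∷ []) ⟩
    2 * suc n        ∎))

  IsCeilHalf : ℕ → ℕ → Set
  IsCeilHalf m n = 2 * m ≡ n ⊎ 2 * m ≡ n + 1

  ceil-half-≥ : ∀ {m n} → IsCeilHalf m n → n ≤ 2 * m
  ceil-half-≥ (inj₁ eq) = ≤-reflexive (sym eq)
  ceil-half-≥ {n = n} (inj₂ eq) = ≤-trans (m≤m+n n 1) (≤-reflexive (sym eq))

  ceil-half-≤ : ∀ {m n} → IsCeilHalf m n → 2 * m ≤ n + 1
  ceil-half-≤ {n = n} (inj₁ eq) = ≤-trans (≤-reflexive eq) (m≤m+n n 1)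
  ceil-half-≤ (inj₂ eq) = ≤-reflexive eq

  ∸-solution : ∀ {r} n k m → k + m ≡ n → r ≡ n ∸ k → r ≡ m
  ∸-solution _ k m refl refl = m+n∸m≡n k m

  ∸-bound : ∀ {r} n k m → k + m ≡ n → r ≤ n ∸ k → r ≤ m
  ∸-bound _ k m refl r≤ = ≤-trans r≤ (≤-reflexive (m+n∸m≡n k m))

  digits : ∀ {b} → 1 ≤ b → ∀ S → ∃₂ λ K E → E < b × b * K + E ≡ S
  digits {b} 1≤b S = S / b , S % b , m%n<n S b , (begin-equality
    b * (S / b) + S % b  ≡⟨ +-comm (b * (S / b)) (S % b) ⟩
    S % b + b * (S / b)  ≡⟨ cong ((S % b) +_) (*-comm b (S / b)) ⟩
    S % b + S / b * b    ≡⟨ m≡m%n+[m/n]*n S b ⟨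
    S                    ∎)
    where
    instance b≢0 : NonZero b
    b≢0 = >-nonZero 1≤b

  leading-digit-≤ : ∀ {b K E K′ E′} → E′ < b → b * K + E ≤ b * K′ + E′ → K ≤ K′
  leading-digit-≤ {b} {K} {E} {K′} {E′} E′<b le = ≮⇒≥ λ K′<K → <⇒≱ (begin-strict
    b * K′ + E′   <⟨ +-monoʳ-< (b * K′) E′<b ⟩
    b * K′ + b    ≡⟨ solve (b ∷ K′ ∷ []) ⟩
    b * suc K′    ≤⟨ *-monoʳ-≤ b K′<K ⟩
    b * K         ≤⟨ m≤m+n (b * K) E ⟩
    b * K + E     ∎) le

  digit-sum-minimal : ∀ {b k e K E} → E < b → b * k + e ≡ b * K + E → K + E ≤ k + e
  digit-sum-minimal {b} {k} {e} {K} {E} E<b eq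
    with j , refl ← m≤n⇒∃[o]m+o≡n (leading-digit-≤ E<b (≤-reflexive eq)) = begin
      k + j + E          ≡⟨ +-assoc k j E ⟩
      k + (j + E)        ≤⟨ +-monoʳ-≤ k (+-monoˡ-≤ E (m≤n*m j b)) ⟩
      k + (b * j + E)    ≡⟨ cong (k +_) e≡bj+E ⟨
      k + e              ∎
    where
    instance b≢0 : NonZero b
    b≢0 = >-nonZero (≤-<-trans z≤n E<b)
    e≡bj+E : e ≡ b * j + E
    e≡bj+E = +-cancelˡ-≡ (b * k) e (b * j + E) (trans eq (solve (b ∷ k ∷ j ∷ E ∷ [])))

  digit-sum-bound : ∀ {b N k e} → 1 ≤ b → b * N ≤ b * k + e + b → N ≤ k + e + 1
  digit-sum-bound {b} {N} {k} {e} 1≤b bN≤ = *-cancelˡ-≤ b (begin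
    b * N              ≤⟨ bN≤ ⟩
    b * k + e + b      ≤⟨ +-monoˡ-≤ b (+-monoʳ-≤ (b * k) (m≤n*m e b)) ⟩
    b * k + b * e + b  ≡⟨ solve (b ∷ k ∷ e ∷ []) ⟩
    b * (k + e + 1)    ∎)
    where
    instance b≢0 : NonZero b
    b≢0 = >-nonZero 1≤b

  -- Combinations of the generators ha + ed

  record Combination : Set where
    constructor ⟨_,_,_,_,_⟩
    field y₁ y₂ y₃ y₄ y₅ : ℕ

  weight : ℕ → Combination → ℕ
  weight b ⟨ y₁ , y₂ , y₃ , y₄ , y₅ ⟩ = y₁ + 2 * y₂ + b * y₃ + (b + 1) * y₄ + 2 * b * y₅

  size : Combination → ℕ
  size ⟨ y₁ , y₂ , y₃ , y₄ , y₅ ⟩ = y₁ + y₂ + y₃ + y₄ + y₅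

  -- not the base-b digits of the weight: units y may exceed b
  tens units : Combination → ℕ
  tens ⟨ y₁ , y₂ , y₃ , y₄ , y₅ ⟩ = 2 * y₅ + (y₃ + y₄)
  units ⟨ y₁ , y₂ , y₃ , y₄ , y₅ ⟩ = 2 * y₂ + (y₁ + y₄)

  weight-digits : ∀ b y → weight b y ≡ b * tens y + units y
  weight-digits b ⟨ y₁ , y₂ , y₃ , y₄ , y₅ ⟩ = expanded
    where
    expanded : y₁ + 2 * y₂ + b * y₃ + (b + 1) * y₄ + 2 * b * y₅ ≡ b * (2 * y₅ + (y₃ + y₄)) + (2 * y₂ + (y₁ + y₄))
    expanded = solve (b ∷ y₁ ∷ y₂ ∷ y₃ ∷ y₄ ∷ y₅ ∷ [])

  size-digits : ∀ y₁ y₂ y₃ y₄ y₅ → let y = ⟨ y₁ , y₂ , y₃ , y₄ , y₅ ⟩ in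
                2 * size y ≡ tens y + units y + (y₁ + y₃)
  size-digits y₁ y₂ y₃ y₄ y₅ = expanded
    where
    expanded : 2 * (y₁ + y₂ + y₃ + y₄ + y₅) ≡ 2 * y₅ + (y₃ + y₄) + (2 * y₂ + (y₁ + y₄)) + (y₁ + y₃)
    expanded = solve (y₁ ∷ y₂ ∷ y₃ ∷ y₄ ∷ y₅ ∷ [])

  digit-sum-≤-2*size : ∀ y → tens y + units y ≤ 2 * size y
  digit-sum-≤-2*size ⟨ y₁ , y₂ , y₃ , y₄ , y₅ ⟩ =
    ≤-trans (m≤m+n _ (y₁ + y₃)) (≤-reflexive (sym (size-digits y₁ y₂ y₃ y₄ y₅)))

  -- every generator except ha + d and ha + bd adds 2 to tens + units
  combination-of-digits : ∀ b y → Combination.y₁ y + Combination.y₃ y ≤ 1 →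
    ∃[ z ] weight b z ≡ b * tens y + units y × 2 * size z ≤ tens y + units y + 1
  combination-of-digits b y@(⟨ y₁ , y₂ , y₃ , y₄ , y₅ ⟩) y₁+y₃≤1 = y , weight-digits b y ,
    ≤-trans (≤-reflexive (size-digits y₁ y₂ y₃ y₄ y₅)) (+-monoʳ-≤ (tens y + units y) y₁+y₃≤1)

  -- ⌊K/2⌋ generators ha + 2bd, ⌊E/2⌋ generators ha + 2d, and one more for the two remainders
  small-combination : ∀ b K E → ∃[ y ] weight b y ≡ b * K + E × 2 * size y ≤ K + E + 1
  small-combination b K E with digits {2} (s≤s z≤n) K | digits {2} (s≤s z≤n) E
  ... | p , 0 , _ , refl | q , 0 , _ , refl = combination-of-digits b ⟨ 0 , q , 0 , 0 , p ⟩ z≤n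
  ... | p , 0 , _ , refl | q , 1 , _ , refl = combination-of-digits b ⟨ 1 , q , 0 , 0 , p ⟩ ≤-refl
  ... | p , 1 , _ , refl | q , 0 , _ , refl = combination-of-digits b ⟨ 0 , q , 1 , 0 , p ⟩ ≤-refl
  ... | p , 1 , _ , refl | q , 1 , _ , refl = combination-of-digits b ⟨ 0 , q , 0 , 1 , p ⟩ z≤n
  ... | _ , suc (suc _) , s≤s (s≤s ()) , _ | _
  ... | _ | _ , suc (suc _) , s≤s (s≤s ()) , _

  size-≥-digit-sum : ∀ {b K E} y → E < b → weight b y ≡ b * K + E → K + E ≤ 2 * size y
  size-≥-digit-sum {b} y E<b w =
    ≤-trans (digit-sum-minimal E<b (trans (sym (weight-digits b y)) w)) (digit-sum-≤-2*size y)

  size-lower-bound : ∀ {a b Ks Es ms} → Es < b → 2 * ms ≤ Ks + Es + 1 →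
    b * (2 * ms) ≤ b * Ks + Es + a + b →
    ∀ y → weight b y ≡ b * Ks + Es ⊎ b * Ks + Es + a ≤ weight b y → ms ≤ size y
  size-lower-bound Es<b 2ms≤ _ y (inj₁ w≡) =
    half-≤ (≤-trans 2ms≤ (+-monoˡ-≤ 1 (size-≥-digit-sum y Es<b w≡)))
  size-lower-bound {a} {b} {Ks} {Es} {ms} Es<b _ b*2ms≤ y (inj₂ Ss+a≤w) =
    half-≤ (≤-trans (digit-sum-bound (≤-<-trans z≤n Es<b) (begin
      b * (2 * ms)                ≤⟨ b*2ms≤ ⟩
      b * Ks + Es + a + b         ≤⟨ +-monoˡ-≤ b Ss+a≤w ⟩
      weight b y + b              ≡⟨ cong (_+ b) (weight-digits b y) ⟩
      b * tens y + units y + b    ∎)) (+-monoˡ-≤ 1 (digit-sum-≤-2*size y)))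

  -- Residues modulo a

  bézout-residue : ∀ {a d} → 1 ≤ a → gcd a d ≡ 1 →
    ∀ n → ∃[ u ] ∃₂ λ P q → n + P * a ≡ u * d + q * a
  bézout-residue {a@(suc a′)} {d} _ coprime n with coprime-Bézout (gcd≡1⇒coprime coprime)
  ... | Bézout.+- x y 1+yd≡xa = n * a′ * y , n * a′ * x , n , (begin-equality
    n + n * a′ * x * a            ≡⟨ solve (n ∷ a′ ∷ x ∷ []) ⟩
    n + n * a′ * (x * a)          ≡⟨ cong (λ t → n + n * a′ * t) 1+yd≡xa ⟨
    n + n * a′ * (1 + y * d)      ≡⟨ solve (n ∷ a′ ∷ y ∷ d ∷ []) ⟩
    n * a′ * y * d + n * a        ∎)
  ... | Bézout.-+ x y 1+xa≡yd = n * y , n * x , 0 , (begin-equality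
    n + n * x * a            ≡⟨ solve (n ∷ x ∷ a′ ∷ []) ⟩
    n * (1 + x * a)          ≡⟨ cong (n *_) 1+xa≡yd ⟩
    n * (y * d)              ≡⟨ solve (n ∷ y ∷ d ∷ a′ ∷ []) ⟩
    n * y * d + 0 * a        ∎)

  residue-of : ∀ {a d} → 1 ≤ a → gcd a d ≡ 1 →
    ∀ n → ∃[ S ] S < a × ∃₂ λ P q → n + P * a ≡ S * d + q * a
  residue-of {a} {d} 1≤a coprime n
    with u , P , q , eq ← bézout-residue 1≤a coprime n
    with t , S , S<a , refl ← digits 1≤a u = S , S<a , P , t * d + q , (begin-equality
      n + P * a                ≡⟨ eq ⟩
      (a * t + S) * d + q * a  ≡⟨ solve (a ∷ t ∷ S ∷ d ∷ q ∷ []) ⟩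
      S * d + (t * d + q) * a  ∎)

  congruent-within-a : ∀ {a n W} X Y → n + X * a ≡ W + Y * a → W < n + a → ∃[ x ] W + x * a ≡ n
  congruent-within-a {a} {n} {W} X Y eq W<n+a with X ≤? Y
  ... | yes X≤Y with j , refl ← m≤n⇒∃[o]m+o≡n X≤Y =
    j , +-cancelʳ-≡ (X * a) (W + j * a) n (begin-equality
      W + j * a + X * a    ≡⟨ solve (W ∷ j ∷ a ∷ X ∷ []) ⟩
      W + (X + j) * a      ≡⟨ eq ⟨
      n + X * a            ∎)
  ... | no X≰Y with j , refl ← m≤n⇒∃[o]m+o≡n (≰⇒> X≰Y) =
    contradiction W<n+a $ ≤⇒≯ $ m+o≡n⇒m≤n (j * a) $ +-cancelʳ-≡ (Y * a) (n + a + j * a) W (begin-equality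
      n + a + j * a + Y * a   ≡⟨ solve (n ∷ a ∷ j ∷ Y ∷ []) ⟩
      n + (suc Y + j) * a     ≡⟨ eq ⟩
      W + Y * a               ∎)

  -- Weights below a with few generators

  cheap-below : ∀ {b Ks Es ms} → Es < b → Ks + Es ≤ 2 * ms → Ks + b ≤ 2 * ms + 2 →
    ∀ S → S ≤ b * Ks + Es → ∃[ y ] weight b y ≡ S × size y ≤ ms
  cheap-below {b} {Ks} {Es} {ms} Es<b Ks+Es≤2ms Ks+b≤2ms+2 S S≤Ss
    with K , E , E<b , refl ← digits (≤-<-trans z≤n Es<b) S
    with y , w , 2size≤ ← small-combination b K E =
    y , w , half-≤ (≤-trans 2size≤ (+-monoˡ-≤ 1 K+E≤2ms))
    where
    K+E≤2ms : K + E ≤ 2 * ms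
    K+E≤2ms with m≤n⇒m<n∨m≡n (leading-digit-≤ Es<b S≤Ss)
    ... | inj₂ refl = ≤-trans (+-monoʳ-≤ K (+-cancelˡ-≤ (b * K) E Es S≤Ss)) Ks+Es≤2ms
    ... | inj₁ K<Ks = +-cancelʳ-≤ 2 (K + E) (2 * ms) (begin
      K + E + 2        ≡⟨ solve (K ∷ E ∷ []) ⟩
      suc K + suc E    ≤⟨ +-mono-≤ K<Ks E<b ⟩
      Ks + b           ≤⟨ Ks+b≤2ms+2 ⟩
      2 * ms + 2       ∎)

  cheap-above : ∀ {a b Ks Es ms} → suc Es ≡ b → a + Ks + 2 ≤ b * (Ks + 1) + 2 * ms →
    ∀ S → b * Ks + Es < S → S < a → ∃[ y ] weight b y ≡ S × suc (size y) ≤ ms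
  cheap-above {a} {b} {Ks} {Es} {ms} refl room S Ss<S S<a
    with K , E , E<b , refl ← digits {suc Es} (s≤s z≤n) S
    with y , w , 2size≤ ← small-combination b K E =
    y , w , half-≤ (begin
      2 * suc (size y)   ≡⟨ *-suc 2 (size y) ⟩
      2 + 2 * size y     ≤⟨ +-monoʳ-≤ 2 2size≤ ⟩
      2 + (K + E + 1)    ≡⟨ solve (K ∷ E ∷ []) ⟩
      K + E + 2 + 1      ≤⟨ +-monoˡ-≤ 1 K+E+2≤2ms ⟩
      2 * ms + 1         ∎)
    where
    Ks<K : Ks < K
    Ks<K = ≰⇒> λ K≤Ks → <⇒≱ Ss<S (+-mono-≤ (*-monoʳ-≤ b K≤Ks) (m<1+n⇒m≤n E<b))
    K+E+2≤2ms : K + E + 2 ≤ 2 * ms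
    K+E+2≤2ms with j , refl ← m≤n⇒∃[o]m+o≡n Ks<K = +-cancelʳ-≤ (b * (Ks + 1)) _ _ (begin
      suc Ks + j + E + 2 + b * (Ks + 1)       ≡⟨ solve (Ks ∷ j ∷ E ∷ Es ∷ []) ⟩
      j + (Ks + 3 + E + b * (Ks + 1))         ≤⟨ +-monoˡ-≤ _ (m≤n*m j b) ⟩
      b * j + (Ks + 3 + E + b * (Ks + 1))     ≡⟨ solve (Es ∷ j ∷ Ks ∷ E ∷ []) ⟩
      Ks + 2 + suc (b * (suc Ks + j) + E)     ≤⟨ +-monoʳ-≤ (Ks + 2) S<a ⟩
      Ks + 2 + a                              ≡⟨ solve (Ks ∷ a ∷ []) ⟩
      a + Ks + 2                              ≤⟨ room ⟩
      b * (Ks + 1) + 2 * ms                   ≡⟨ +-comm (b * (Ks + 1)) (2 * ms) ⟩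
      2 * ms + b * (Ks + 1)                   ∎)

  -- The Frobenius number from an extremal residue

  ∣⇒≡0⊎≥ : ∀ {a D} → a ∣ D → D ≡ 0 ⊎ a ≤ D
  ∣⇒≡0⊎≥ {D = zero} _ = inj₁ refl
  ∣⇒≡0⊎≥ {D = suc _} a∣D = inj₂ (∣⇒≤ a∣D)

  shift-⊖ : ∀ {n} {as : Vec ℕ n} G a y p → G + y ≡ p → IsFrobeniusNumber as (G ⊖ a) →
            IsFrobeniusNumber as (p ⊖ (a + y))
  shift-⊖ {as = as} G a y _ refl = subst (IsFrobeniusNumber as)
    (trans (sym (ℤₚ.+-cancelˡ-⊖ y G a)) (cong₂ _⊖_ (+-comm y G) (+-comm y a)))

  module _ {a h d b : ℕ} (coprime : gcd a d ≡ 1) (1≤h : 1 ≤ h) where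

    element : ℕ → Combination → Vec ℕ 6
    element x₀ ⟨ y₁ , y₂ , y₃ , y₄ , y₅ ⟩ = Vec.fromList (x₀ ∷ y₁ ∷ y₂ ∷ y₃ ∷ y₄ ∷ y₅ ∷ [])

    element-value : ∀ x₀ y → Vec.sum (Vec.zipWith _*_ (element x₀ y) (A a h d b))
                             ≡ x₀ * a + (size y * h * a + weight b y * d)
    element-value x₀ ⟨ y₁ , y₂ , y₃ , y₄ , y₅ ⟩ = expanded
      where
      expanded : x₀ * a + (y₁ * (h * a + d) + (y₂ * (h * a + 2 * d) + (y₃ * (h * a + b * d)
                   + (y₄ * (h * a + (b + 1) * d) + (y₅ * (h * a + 2 * b * d) + 0)))))
               ≡ x₀ * a + ((y₁ + y₂ + y₃ + y₄ + y₅) * h * a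
                          + (y₁ + 2 * y₂ + b * y₃ + (b + 1) * y₄ + 2 * b * y₅) * d)
      expanded = solve (x₀ ∷ a ∷ h ∷ d ∷ b ∷ y₁ ∷ y₂ ∷ y₃ ∷ y₄ ∷ y₅ ∷ [])

    cancel-residue : ∀ X Y V D → X * a + (V + D) * d ≡ Y * a + V * d → X * a + D * d ≡ Y * a
    cancel-residue X Y V D eq = +-cancelʳ-≡ (V * d) (X * a + D * d) (Y * a) (begin-equality
      X * a + D * d + V * d   ≡⟨ solve (X ∷ a ∷ D ∷ d ∷ V ∷ []) ⟩
      X * a + (V + D) * d     ≡⟨ eq ⟩
      Y * a + V * d           ∎)

    a∣residue : ∀ X Y D → X * a + D * d ≡ Y * a → a ∣ D
    a∣residue X Y D eq = coprime-divisor (gcd≡1⇒coprime coprime) (subst (a ∣_) (*-comm D d)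
      (∣m+n∣m⇒∣n (subst (a ∣_) (sym eq) (n∣m*n Y)) (n∣m*n X)))

    -- As a and d are coprime, the equation forces W ≡ Ss modulo a with W ≥ Ss, and then c < ms.
    gap-unrepresentable : ∀ {Ss ms} → Ss < a → ∀ x₀ c W → (W ≡ Ss ⊎ Ss + a ≤ W → ms ≤ c) →
      x₀ * a + (c * h * a + W * d) + a ≡ ms * h * a + Ss * d → ⊥
    gap-unrepresentable {Ss} {ms} Ss<a x₀ c W enough eq with Ss ≤? W
    ... | no Ss≰W with D , refl ← m≤n⇒∃[o]m+o≡n (≰⇒> Ss≰W) =
      <⇒≱ Ss<a (≤-trans (∣⇒≤ a∣1+D) (s≤s (m≤n+m D W)))
      where
      a∣1+D : a ∣ suc D
      a∣1+D = a∣residue (ms * h) (x₀ + c * h + 1) (suc D) $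
        cancel-residue (ms * h) (x₀ + c * h + 1) W (suc D) (begin-equality
        ms * h * a + (W + suc D) * d            ≡⟨ solve (ms ∷ h ∷ a ∷ W ∷ D ∷ d ∷ []) ⟩
        ms * h * a + (suc W + D) * d            ≡⟨ eq ⟨
        x₀ * a + (c * h * a + W * d) + a        ≡⟨ solve (x₀ ∷ a ∷ c ∷ h ∷ W ∷ d ∷ []) ⟩
        (x₀ + c * h + 1) * a + W * d            ∎)
    ... | yes Ss≤W with D , refl ← m≤n⇒∃[o]m+o≡n Ss≤W =
      <⇒≱ c<ms $ enough $ Sum.map (λ { refl → +-identityʳ Ss }) (+-monoʳ-≤ Ss) $
        ∣⇒≡0⊎≥ (a∣residue (x₀ + c * h + 1) (ms * h) D balance)
      where
      instance a≢0 : NonZero a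
      a≢0 = >-nonZero (≤-<-trans z≤n Ss<a)
      balance : (x₀ + c * h + 1) * a + D * d ≡ ms * h * a
      balance = cancel-residue (x₀ + c * h + 1) (ms * h) Ss D (begin-equality
        (x₀ + c * h + 1) * a + (Ss + D) * d     ≡⟨ solve (x₀ ∷ c ∷ h ∷ a ∷ Ss ∷ D ∷ d ∷ []) ⟩
        x₀ * a + (c * h * a + (Ss + D) * d) + a  ≡⟨ eq ⟩
        ms * h * a + Ss * d                     ∎)
      c<ms : c < ms
      c<ms = *-cancelʳ-< h c ms (begin-strict
        c * h                  <⟨ m+o≡n⇒m≤n x₀ (solve (c ∷ h ∷ x₀ ∷ [])) ⟩
        x₀ + c * h + 1         ≤⟨ *-cancelʳ-≤ _ _ a (≤-trans (m≤m+n _ (D * d)) (≤-reflexive balance)) ⟩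
        ms * h                 ∎)

    congruent-to-cost : ∀ n P q W c → n + P * a ≡ W * d + q * a →
      n + (P + c * h) * a ≡ c * h * a + W * d + q * a
    congruent-to-cost n P q W c eq = begin-equality
      n + (P + c * h) * a        ≡⟨ solve (n ∷ P ∷ c ∷ h ∷ a ∷ []) ⟩
      n + P * a + c * h * a      ≡⟨ cong (_+ c * h * a) eq ⟩
      W * d + q * a + c * h * a  ≡⟨ solve (W ∷ d ∷ q ∷ a ∷ c ∷ h ∷ []) ⟩
      c * h * a + W * d + q * a  ∎

    frobenius-number : ∀ {Ss ms} → 1 ≤ ms → Ss < a →
      (∀ y → weight b y ≡ Ss ⊎ Ss + a ≤ weight b y → ms ≤ size y) →
      (∀ S → S < a → ∃[ y ] weight b y ≡ S × size y * h * a + S * d ≤ ms * h * a + Ss * d) →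
      IsFrobeniusNumber (A a h d b) ((ms * h * a + Ss * d) ⊖ a)
    frobenius-number {Ss} {ms} 1≤ms Ss<a enough cheap =
      subst (IsFrobeniusNumber (A a h d b)) (sym (ℤₚ.⊖-≥ a≤G)) (unreachable , reachable)
      where
      G : ℕ
      G = ms * h * a + Ss * d

      a≤G : a ≤ G
      a≤G = begin
        a                ≡⟨ *-identityˡ a ⟨
        1 * a            ≤⟨ *-monoˡ-≤ a (*-mono-≤ 1≤ms 1≤h) ⟩
        ms * h * a       ≤⟨ m≤m+n (ms * h * a) (Ss * d) ⟩
        G                ∎

      unreachable : ¬ Representableℤ (A a h d b) (ℤ.+ (G ∸ a))
      unreachable (m , G∸a≡m , (x₀ Vec.∷ y₁ Vec.∷ y₂ Vec.∷ y₃ Vec.∷ y₄ Vec.∷ y₅ Vec.∷ Vec.[]) , sum≡m) =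
        gap-unrepresentable Ss<a x₀ (size y) (weight b y) (enough y) (begin-equality
          x₀ * a + (size y * h * a + weight b y * d) + a  ≡⟨ cong (_+ a) (trans (sym (element-value x₀ y)) sum≡m) ⟩
          m + a                                          ≡⟨ cong (_+ a) (ℤₚ.+-injective G∸a≡m) ⟨
          G ∸ a + a                                      ≡⟨ m∸n+n≡m a≤G ⟩
          G                                              ∎)
        where
        y : Combination
        y = ⟨ y₁ , y₂ , y₃ , y₄ , y₅ ⟩

      reach : ∀ n → G < n + a → Representable (A a h d b) n
      reach n G<n+a
        with S , S<a , P , q , n+Pa≡Sd+qa ← residue-of (≤-<-trans z≤n Ss<a) coprime n
        with y , refl , cost≤G ← cheap S S<a
        with x₀ , cost+x₀a≡n ← congruent-within-a (P + size y * h) q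
                                 (congruent-to-cost n P q (weight b y) (size y) n+Pa≡Sd+qa)
                                 (≤-<-trans cost≤G G<n+a) =
        element x₀ y , (begin-equality
          Vec.sum (Vec.zipWith _*_ (element x₀ y) (A a h d b))  ≡⟨ element-value x₀ y ⟩
          x₀ * a + (size y * h * a + weight b y * d)           ≡⟨ +-comm (x₀ * a) _ ⟩
          size y * h * a + weight b y * d + x₀ * a             ≡⟨ cost+x₀a≡n ⟩
          n                                                    ∎)

      reachable : ∀ z → z ℤ.> ℤ.+ (G ∸ a) → Representableℤ (A a h d b) z
      reachable (ℤ.+ n) (ℤ.+<+ G∸a<n) = n , refl , reach n (begin-strict
        G            ≡⟨ m∸n+n≡m a≤G ⟨
        G ∸ a + a    <⟨ +-monoˡ-< a G∸a<n ⟩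
        n + a        ∎)
      reachable ℤ.-[1+ _ ] ()

    cost-below : ∀ {c S ms Ss} → c ≤ ms → S ≤ Ss → c * h * a + S * d ≤ ms * h * a + Ss * d
    cost-below c≤ms S≤Ss = +-mono-≤ (*-monoˡ-≤ a (*-monoˡ-≤ h c≤ms)) (*-monoˡ-≤ d S≤Ss)

    cost-above : ∀ {c S ms Ss} → suc c ≤ ms → S ≤ Ss + b → b * d ≤ h * a →
                 c * h * a + S * d ≤ ms * h * a + Ss * d
    cost-above {c} {S} {ms} {Ss} c<ms S≤Ss+b bd≤ha = begin
      c * h * a + S * d           ≤⟨ +-monoʳ-≤ (c * h * a) (*-monoˡ-≤ d S≤Ss+b) ⟩
      c * h * a + (Ss + b) * d    ≡⟨ solve (c ∷ h ∷ a ∷ Ss ∷ b ∷ d ∷ []) ⟩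
      c * h * a + b * d + Ss * d  ≤⟨ +-monoˡ-≤ (Ss * d) (+-monoʳ-≤ (c * h * a) bd≤ha) ⟩
      c * h * a + h * a + Ss * d  ≡⟨ solve (c ∷ h ∷ a ∷ Ss ∷ d ∷ []) ⟩
      suc c * h * a + Ss * d      ≤⟨ cost-below {suc c} {Ss} c<ms ≤-refl ⟩
      ms * h * a + Ss * d         ∎

    frobenius-of-extremal : ∀ Ks Es ms y p → IsCeilHalf ms (Ks + Es) → 1 ≤ ms →
      b * (2 * ms) ≤ b * Ks + Es + a + b → Es < b → b * Ks + Es < a →
      (∀ S → S < a → ∃[ z ] weight b z ≡ S × size z * h * a + S * d ≤ ms * h * a + (b * Ks + Es) * d) →
      ms * h * a + (b * Ks + Es) * d + y ≡ p → IsFrobeniusNumber (A a h d b) (p ⊖ (a + y))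
    frobenius-of-extremal Ks Es ms y p ms≡⌈Ks+Es/2⌉ 1≤ms b*2ms≤ Es<b Ss<a cheap G+y≡p =
      shift-⊖ (ms * h * a + (b * Ks + Es) * d) a y p G+y≡p $
      frobenius-number {b * Ks + Es} {ms} 1≤ms Ss<a
        (size-lower-bound {a} {b} {Ks} {Es} {ms} Es<b (ceil-half-≤ {ms} ms≡⌈Ks+Es/2⌉) b*2ms≤) cheap

    frobenius-at-a∸1 : ∀ Ks Es ms y p → IsCeilHalf ms (Ks + Es) → 1 ≤ ms →
      b * (2 * ms) ≤ b * Ks + Es + a + b → Es < b → Ks + b ≤ 2 * ms + 2 → a ≡ b * Ks + Es + 1 →
      ms * h * a + (b * Ks + Es) * d + y ≡ p → IsFrobeniusNumber (A a h d b) (p ⊖ (a + y))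
    frobenius-at-a∸1 Ks Es ms y p ms≡⌈Ks+Es/2⌉ 1≤ms b*2ms≤ Es<b Ks+b≤ a≡Ss+1 =
      frobenius-of-extremal Ks Es ms y p ms≡⌈Ks+Es/2⌉ 1≤ms b*2ms≤ Es<b Ss<a cheap
      where
      Ss<a : b * Ks + Es < a
      Ss<a = ≤-reflexive (trans (+-comm 1 (b * Ks + Es)) (sym a≡Ss+1))
      S≤Ss : ∀ {S} → S < a → S ≤ b * Ks + Es
      S≤Ss S<a = m<1+n⇒m≤n (<-≤-trans S<a (≤-reflexive (trans a≡Ss+1 (+-comm _ 1))))
      cheap : ∀ S → S < a → ∃[ z ] weight b z ≡ S × size z * h * a + S * d ≤ ms * h * a + (b * Ks + Es) * d
      cheap S S<a
        with z , w , size≤ms ← cheap-below {ms = ms} Es<b (ceil-half-≥ {ms} ms≡⌈Ks+Es/2⌉) Ks+b≤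
                                             S (S≤Ss S<a) =
        z , w , cost-below size≤ms (S≤Ss S<a)

    frobenius-at-digit-b∸1 : ∀ Ks Es ms y p → IsCeilHalf ms (Ks + Es) → 1 ≤ ms →
      b * (2 * ms) ≤ b * Ks + Es + a + b → suc Es ≡ b → b * Ks + Es < a →
      a + Ks + 2 ≤ b * (Ks + 1) + 2 * ms → b * d ≤ h * a →
      ms * h * a + (b * Ks + Es) * d + y ≡ p → IsFrobeniusNumber (A a h d b) (p ⊖ (a + y))
    frobenius-at-digit-b∸1 Ks Es ms y p ms≡⌈Ks+Es/2⌉ 1≤ms b*2ms≤ 1+Es≡b Ss<a room bd≤ha =
      frobenius-of-extremal Ks Es ms y p ms≡⌈Ks+Es/2⌉ 1≤ms b*2ms≤ (≤-reflexive 1+Es≡b) Ss<a cheap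
      where
      Ks+Es≤2ms : Ks + Es ≤ 2 * ms
      Ks+Es≤2ms = ceil-half-≥ {ms} ms≡⌈Ks+Es/2⌉
      Ks+b≤ : Ks + b ≤ 2 * ms + 2
      Ks+b≤ = begin
        Ks + b           ≡⟨ cong (Ks +_) 1+Es≡b ⟨
        Ks + suc Es      ≡⟨ +-suc Ks Es ⟩
        suc (Ks + Es)    ≤⟨ s≤s Ks+Es≤2ms ⟩
        suc (2 * ms)     ≤⟨ n≤1+n _ ⟩
        2 + 2 * ms       ≡⟨ +-comm 2 (2 * ms) ⟩
        2 * ms + 2       ∎
      S≤Ss+b : ∀ {S} → S < a → S ≤ b * Ks + Es + b
      S≤Ss+b {S} S<a = +-cancelʳ-≤ (Ks + 2) S (b * Ks + Es + b) (begin
        S + (Ks + 2)                  ≤⟨ +-monoˡ-≤ (Ks + 2) (<⇒≤ S<a) ⟩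
        a + (Ks + 2)                  ≡⟨ +-assoc a Ks 2 ⟨
        a + Ks + 2                    ≤⟨ room ⟩
        b * (Ks + 1) + 2 * ms         ≤⟨ +-monoʳ-≤ (b * (Ks + 1)) (ceil-half-≤ {ms} ms≡⌈Ks+Es/2⌉) ⟩
        b * (Ks + 1) + (Ks + Es + 1)  ≡⟨ solve (b ∷ Ks ∷ Es ∷ []) ⟩
        b * Ks + Es + b + (Ks + 1)    ≤⟨ +-monoʳ-≤ (b * Ks + Es + b) (+-monoʳ-≤ Ks (n≤1+n 1)) ⟩
        b * Ks + Es + b + (Ks + 2)    ∎)
      cheap : ∀ S → S < a → ∃[ z ] weight b z ≡ S × size z * h * a + S * d ≤ ms * h * a + (b * Ks + Es) * d
      cheap S S<a with S ≤? b * Ks + Es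
      ... | yes S≤Ss
        with z , w , size≤ms ← cheap-below {ms = ms} (≤-reflexive 1+Es≡b) Ks+Es≤2ms Ks+b≤ S S≤Ss =
        z , w , cost-below size≤ms S≤Ss
      ... | no S≰Ss
        with z , w , size<ms ← cheap-above {ms = ms} 1+Es≡b room S (≰⇒> S≰Ss) S<a =
        z , w , cost-above size<ms (S≤Ss+b S<a) bd≤ha

  ⌈/⌉-≤ : ∀ {m k h} → ⌈ m / suc k ⌉ ≤ h → m ≤ h * suc k
  ⌈/⌉-≤ {m} {k} {h} ⌈m/k+1⌉≤h = +-cancelʳ-≤ k m (h * suc k) (begin
    m + k                                        ≡⟨ m≡m%n+[m/n]*n (m + k) (suc k) ⟩
    (m + k) % suc k + (m + k) / suc k * suc k    ≤⟨ +-mono-≤ (m<1+n⇒m≤n (m%n<n (m + k) (suc k)))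
                                                            (*-monoˡ-≤ (suc k) ⌈m/k+1⌉≤h) ⟩
    k + h * suc k                                ≡⟨ +-comm k (h * suc k) ⟩
    h * suc k + k                                ∎)

  quotient-≥ : ∀ {n M Q r} → r < n → n * M ≤ r + Q * n → M ≤ Q
  quotient-≥ {n} {M} {Q} {r} r<n nM≤ = m<1+n⇒m≤n (*-cancelˡ-< n M (suc Q) (begin-strict
    n * M        ≤⟨ nM≤ ⟩
    r + Q * n    <⟨ +-monoˡ-< (Q * n) r<n ⟩
    n + Q * n    ≡⟨ *-comm (suc Q) n ⟩
    n * suc Q    ∎))

  parity-split : ∀ {b p} → b % 2 ≡ p → 4 ≤ b → ∃[ β ] b ≡ p + (4 + 2 * β)
  parity-split {b} {p} b%2≡p 4≤b
    with β , 2+β≡b/2 ← m≤n⇒∃[o]m+o≡n (/-monoˡ-≤ 2 4≤b) = β , (begin-equality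
    b                   ≡⟨ m≡m%n+[m/n]*n b 2 ⟩
    b % 2 + b / 2 * 2   ≡⟨ cong₂ (λ x y → x + y * 2) b%2≡p (sym 2+β≡b/2) ⟩
    p + (2 + β) * 2     ≡⟨ solve (p ∷ β ∷ []) ⟩
    p + (4 + 2 * β)     ∎)

  half-even : ∀ β → (4 + 2 * β) / 2 ≡ 2 + β
  half-even β = begin-equality
    (4 + 2 * β) / 2     ≡⟨ cong (_/ 2) {4 + 2 * β} {(2 + β) * 2} (solve (β ∷ [])) ⟩
    (2 + β) * 2 / 2     ≡⟨ m*n/n≡m (2 + β) 2 ⟩
    2 + β               ∎

  pred-half-even : ∀ Q β → (Q + (4 + 2 * β) / 2) ∸ 1 ≡ Q + (1 + β)
  pred-half-even Q β rewrite half-even β = cong (_∸ 1) (+-suc Q (1 + β))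

  half-odd : ∀ β → (5 + 2 * β ∸ 1) / 2 ≡ 2 + β
  half-odd = half-even

  ≤-by-bound : ∀ {m n r r′} → r ≤ r′ → ∀ k → m ≡ r + k → r′ + k ≤ n → m ≤ n
  ≤-by-bound {m} {n} {r} {r′} r≤r′ k m≡r+k r′+k≤n = begin
    m        ≡⟨ m≡r+k ⟩
    r + k    ≤⟨ +-monoˡ-≤ k r≤r′ ⟩
    r′ + k   ≤⟨ r′+k≤n ⟩
    n        ∎

  b*d≤h*a : ∀ {a b c d h} → 2 * d ≤ h * c → b * c ≤ a → b * d ≤ h * a
  b*d≤h*a {a} {b} {c} {d} {h} 2d≤hc bc≤a = begin
    b * d          ≤⟨ *-monoʳ-≤ b (m≤n*m d 2) ⟩
    b * (2 * d)    ≤⟨ *-monoʳ-≤ b 2d≤hc ⟩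
    b * (h * c)    ≡⟨ solve (b ∷ h ∷ c ∷ []) ⟩
    h * (b * c)    ≤⟨ *-monoʳ-≤ h bc≤a ⟩
    h * a          ∎

  -- Q ≥ β + 1 because a ≥ b(b − 2) = 2b(β + 1)
  record EvenSetting (a h d b Q r : ℕ) : Set where
    constructor even-setting
    field
      β u : ℕ
      b≡ : b ≡ 4 + 2 * β
      Q≡ : Q ≡ β + 1 + u
      a≡ : a ≡ r + Q * (2 * b)
      coprime : gcd a d ≡ 1
      1≤h : 1 ≤ h
      bd≤ha : b * d ≤ h * a

  -- Q ≥ β + 2 because a ≥ b(b − 1) = 2b(β + 2)
  record OddSetting (a h d b Q r : ℕ) : Set where
    constructor odd-setting
    field
      β u : ℕ
      b≡ : b ≡ 5 + 2 * β
      Q≡ : Q ≡ β + 2 + u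
      a≡ : a ≡ r + Q * (2 * b)
      coprime : gcd a d ≡ 1
      1≤h : 1 ≤ h
      bd≤ha : b * d ≤ h * a

  even-setting-of : ∀ {a h d b} → 4 ≤ b → b % 2 ≡ 0 → ⌈ (2 * d) / (b ∸ 2) ⌉ ≤ h → b * (b ∸ 2) ≤ a →
    gcd a d ≡ 1 → 1 ≤ h → EvenSetting a h d b ⌊ a / (2 * b) ⌋ (a mod (2 * b))
  even-setting-of {a} {h} {d} 4≤b b%2≡0 ⌈2d/b-2⌉≤h b[b-2]≤a coprime 1≤h
    with β , refl ← parity-split b%2≡0 4≤b
    with u , β+1+u≡Q ← m≤n⇒∃[o]m+o≡n (quotient-≥ (m%n<n a (2 * (4 + 2 * β))) (begin
      2 * (4 + 2 * β) * (β + 1)   ≡⟨ solve (β ∷ []) ⟩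
      (4 + 2 * β) * (2 + 2 * β)   ≤⟨ b[b-2]≤a ⟩
      a                           ≡⟨ m≡m%n+[m/n]*n a (2 * (4 + 2 * β)) ⟩
      a % (2 * (4 + 2 * β)) + a / (2 * (4 + 2 * β)) * (2 * (4 + 2 * β)) ∎)) =
    even-setting β u refl (sym β+1+u≡Q) (m≡m%n+[m/n]*n a _) coprime 1≤h
      (b*d≤h*a {a} {4 + 2 * β} {2 + 2 * β} {d} {h} (⌈/⌉-≤ {2 * d} {1 + 2 * β} ⌈2d/b-2⌉≤h) b[b-2]≤a)

  odd-setting-of : ∀ {a h d b} → 4 ≤ b → b % 2 ≡ 1 → ⌈ (2 * d) / (b ∸ 1) ⌉ ≤ h → b * (b ∸ 1) ≤ a →
    gcd a d ≡ 1 → 1 ≤ h → OddSetting a h d b ⌊ a / (2 * b) ⌋ (a mod (2 * b))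
  odd-setting-of {a} {h} {d} 4≤b b%2≡1 ⌈2d/b-1⌉≤h b[b-1]≤a coprime 1≤h
    with β , refl ← parity-split b%2≡1 4≤b
    with u , β+2+u≡Q ← m≤n⇒∃[o]m+o≡n (quotient-≥ (m%n<n a (2 * (5 + 2 * β))) (begin
      2 * (5 + 2 * β) * (β + 2)   ≡⟨ solve (β ∷ []) ⟩
      (5 + 2 * β) * (4 + 2 * β)   ≤⟨ b[b-1]≤a ⟩
      a                           ≡⟨ m≡m%n+[m/n]*n a (2 * (5 + 2 * β)) ⟩
      a % (2 * (5 + 2 * β)) + a / (2 * (5 + 2 * β)) * (2 * (5 + 2 * β)) ∎)) =
    odd-setting β u refl (sym β+2+u≡Q) (m≡m%n+[m/n]*n a _) coprime 1≤h
      (b*d≤h*a {a} {5 + 2 * β} {4 + 2 * β} {d} {h} (⌈/⌉-≤ {2 * d} {3 + 2 * β} ⌈2d/b-1⌉≤h) b[b-1]≤a)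

  -- The ten cases
  --
  -- With b and Q replaced by polynomials in β and u, every side condition is a polynomial identity,
  -- or an inequality whose slack is given explicitly, checked by the ring solver.
  even-residue-small : ∀ {a h d b Q r} → EvenSetting a h d b Q r → r ≤ b ∸ 3 →
    IsFrobeniusNumber (A a h d b) ((((Q + b / 2) ∸ 1) * h * a + 2 * b * d * Q) ⊖ (a + d))
  even-residue-small {a} {h} {d} {b} {Q} {r} (even-setting β u refl refl refl coprime 1≤h bd≤ha) r≤b-3 =
    subst (λ M → IsFrobeniusNumber (A a h d b) ((M * h * a + 2 * b * d * Q) ⊖ (a + d)))
      (sym (pred-half-even Q β)) $
    frobenius-at-digit-b∸1 {a} {h} {d} {b} coprime 1≤h (2 * (β + u) + 1) (3 + 2 * β) (Q + (1 + β))
      d ((Q + (1 + β)) * h * a + 2 * b * d * Q)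
      (inj₁ (solve vs))
      (m+o≡n⇒m≤n (1 + u + 2 * β) (solve vs))
      (m+o≡n⇒m≤n (3 + r + 8 * u + 2 * β + 4 * β * u) (solve vs))
      refl
      (m+o≡n⇒m≤n r (solve vs))
      (≤-by-bound (∸-bound b 3 (1 + 2 * β) refl r≤b-3) (Q * (2 * b) + (2 * (β + u) + 1) + 2)
        (solve vs) (≤-reflexive (solve vs)))
      bd≤ha
      (solve vs)
    where
    vs : List ℕ
    vs = β ∷ u ∷ r ∷ h ∷ d ∷ []

  even-residue-b-2 : ∀ {a h d b Q r} → EvenSetting a h d b Q r → r ≡ b ∸ 2 →
    IsFrobeniusNumber (A a h d b) ((((Q + b / 2) ∸ 1) * h * a + 2 * b * d * Q + b * d) ⊖ (a + 3 * d))
  even-residue-b-2 {a} {h} {d} {b} {Q} (even-setting β u refl refl refl coprime 1≤h _) r≡b-2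
    with refl ← ∸-solution b 2 (2 + 2 * β) refl r≡b-2 =
    subst (λ M → IsFrobeniusNumber (A a h d b) ((M * h * a + 2 * b * d * Q + b * d) ⊖ (a + 3 * d)))
      (sym (pred-half-even Q β)) $
    frobenius-at-a∸1 {a} {h} {d} {b} coprime 1≤h (2 * Q) (1 + 2 * β) (Q + (1 + β))
      (3 * d) ((Q + (1 + β)) * h * a + 2 * b * d * Q + b * d)
      (inj₂ (solve vs))
      (m+o≡n⇒m≤n (1 + u + 2 * β) (solve vs))
      (m+o≡n⇒m≤n (7 + 8 * u + 6 * β + 4 * β * u) (solve vs))
      (m+o≡n⇒m≤n 2 (solve vs))
      (≤-reflexive (solve vs))
      (solve vs)
      (solve vs)
    where
    vs : List ℕ
    vs = β ∷ u ∷ h ∷ d ∷ []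

  even-residue-b-1 : ∀ {a h d b Q r} → EvenSetting a h d b Q r → r ≡ b ∸ 1 →
    IsFrobeniusNumber (A a h d b) ((((Q + b / 2) ∸ 1) * h * a + 2 * b * d * Q + b * d) ⊖ (a + 2 * d))
  even-residue-b-1 {a} {h} {d} {b} {Q} (even-setting β u refl refl refl coprime 1≤h _) r≡b-1
    with refl ← ∸-solution b 1 (3 + 2 * β) refl r≡b-1 =
    subst (λ M → IsFrobeniusNumber (A a h d b) ((M * h * a + 2 * b * d * Q + b * d) ⊖ (a + 2 * d)))
      (sym (pred-half-even Q β)) $
    frobenius-at-a∸1 {a} {h} {d} {b} coprime 1≤h (2 * Q) (2 + 2 * β) (Q + (1 + β))
      (2 * d) ((Q + (1 + β)) * h * a + 2 * b * d * Q + b * d)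
      (inj₁ (solve vs))
      (m+o≡n⇒m≤n (1 + u + 2 * β) (solve vs))
      (m+o≡n⇒m≤n (9 + 8 * u + 6 * β + 4 * β * u) (solve vs))
      (m+o≡n⇒m≤n 1 (solve vs))
      (≤-reflexive (solve vs))
      (solve vs)
      (solve vs)
    where
    vs : List ℕ
    vs = β ∷ u ∷ h ∷ d ∷ []

  even-residue-large : ∀ {a h d b Q r} → EvenSetting a h d b Q r → b ≤ r → r ≤ 2 * b ∸ 2 →
    IsFrobeniusNumber (A a h d b) (((Q + b / 2) * h * a + 2 * b * d * Q + b * d) ⊖ (a + d))
  even-residue-large {a} {h} {d} {b} {Q} (even-setting β u refl refl refl coprime 1≤h bd≤ha) b≤r r≤2b-2
    with r₀ , refl ← m≤n⇒∃[o]m+o≡n b≤r =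
    subst (λ H → IsFrobeniusNumber (A a h d b) (((Q + H) * h * a + 2 * b * d * Q + b * d) ⊖ (a + d)))
      (sym (half-even β)) $
    frobenius-at-digit-b∸1 {a} {h} {d} {b} coprime 1≤h (2 * Q) (3 + 2 * β) (Q + (2 + β))
      d ((Q + (2 + β)) * h * a + 2 * b * d * Q + b * d)
      (inj₂ (solve vs))
      (m+o≡n⇒m≤n (2 + u + 2 * β) (solve vs))
      (m+o≡n⇒m≤n (3 + r₀ + 8 * u + 2 * β + 4 * β * u) (solve vs))
      refl
      (m+o≡n⇒m≤n r₀ (solve vs))
      (≤-by-bound (∸-bound (2 * b) 2 (6 + 4 * β) (solve vs) r≤2b-2) (Q * (2 * b) + 2 * Q + 2)
        (solve vs) (≤-reflexive (solve vs)))
      bd≤ha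
      (solve vs)
    where
    vs : List ℕ
    vs = β ∷ u ∷ r₀ ∷ h ∷ d ∷ []

  even-residue-2b-1 : ∀ {a h d b Q r} → EvenSetting a h d b Q r → r ≡ 2 * b ∸ 1 →
    IsFrobeniusNumber (A a h d b) (((Q + b / 2) * h * a + 2 * b * d * Q + 2 * b * d) ⊖ (a + 2 * d))
  even-residue-2b-1 {a} {h} {d} {b} {Q} (even-setting β u refl refl refl coprime 1≤h _) r≡2b-1
    with refl ← ∸-solution (2 * b) 1 (7 + 4 * β) (solve (β ∷ [])) r≡2b-1 =
    subst (λ H → IsFrobeniusNumber (A a h d b) (((Q + H) * h * a + 2 * b * d * Q + 2 * b * d) ⊖ (a + 2 * d)))
      (sym (half-even β)) $
    frobenius-at-a∸1 {a} {h} {d} {b} coprime 1≤h (2 * Q + 1) (2 + 2 * β) (Q + (2 + β))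
      (2 * d) ((Q + (2 + β)) * h * a + 2 * b * d * Q + 2 * b * d)
      (inj₂ (solve vs))
      (m+o≡n⇒m≤n (2 + u + 2 * β) (solve vs))
      (m+o≡n⇒m≤n (9 + 8 * u + 6 * β + 4 * β * u) (solve vs))
      (m+o≡n⇒m≤n 1 (solve vs))
      (m+o≡n⇒m≤n 1 (solve vs))
      (solve vs)
      (solve vs)
    where
    vs : List ℕ
    vs = β ∷ u ∷ h ∷ d ∷ []

  odd-residue-small : ∀ {a h d b Q r} → OddSetting a h d b Q r → r ≤ b ∸ 2 →
    IsFrobeniusNumber (A a h d b) (((Q + (b ∸ 1) / 2) * h * a + 2 * b * d * Q) ⊖ (a + d))
  odd-residue-small {a} {h} {d} {b} {Q} {r} (odd-setting β u refl refl refl coprime 1≤h bd≤ha) r≤b-2 =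
    subst (λ H → IsFrobeniusNumber (A a h d b) (((Q + H) * h * a + 2 * b * d * Q) ⊖ (a + d)))
      (sym (half-odd β)) $
    frobenius-at-digit-b∸1 {a} {h} {d} {b} coprime 1≤h (2 * (β + 1 + u) + 1) (4 + 2 * β) (Q + (2 + β))
      d ((Q + (2 + β)) * h * a + 2 * b * d * Q)
      (inj₂ (solve vs))
      (m+o≡n⇒m≤n (3 + u + 2 * β) (solve vs))
      (m+o≡n⇒m≤n (4 + r + 10 * u + 2 * β + 4 * β * u) (solve vs))
      refl
      (m+o≡n⇒m≤n r (solve vs))
      (≤-by-bound (∸-bound b 2 (3 + 2 * β) refl r≤b-2) (Q * (2 * b) + (2 * (β + 1 + u) + 1) + 2)
        (solve vs) (≤-reflexive (solve vs)))
      bd≤ha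
      (solve vs)
    where
    vs : List ℕ
    vs = β ∷ u ∷ r ∷ h ∷ d ∷ []

  odd-residue-b-1 : ∀ {a h d b Q r} → OddSetting a h d b Q r → r ≡ b ∸ 1 →
    IsFrobeniusNumber (A a h d b) (((Q + (b ∸ 1) / 2) * h * a + 2 * b * d * Q + b * d) ⊖ (a + 2 * d))
  odd-residue-b-1 {a} {h} {d} {b} {Q} (odd-setting β u refl refl refl coprime 1≤h _) r≡b-1
    with refl ← ∸-solution b 1 (4 + 2 * β) refl r≡b-1 =
    subst (λ H → IsFrobeniusNumber (A a h d b) (((Q + H) * h * a + 2 * b * d * Q + b * d) ⊖ (a + 2 * d)))
      (sym (half-odd β)) $
    frobenius-at-a∸1 {a} {h} {d} {b} coprime 1≤h (2 * Q) (3 + 2 * β) (Q + (2 + β))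
      (2 * d) ((Q + (2 + β)) * h * a + 2 * b * d * Q + b * d)
      (inj₂ (solve vs))
      (m+o≡n⇒m≤n (3 + u + 2 * β) (solve vs))
      (m+o≡n⇒m≤n (12 + 10 * u + 6 * β + 4 * β * u) (solve vs))
      (m+o≡n⇒m≤n 1 (solve vs))
      (m+o≡n⇒m≤n 1 (solve vs))
      (solve vs)
      (solve vs)
    where
    vs : List ℕ
    vs = β ∷ u ∷ h ∷ d ∷ []

  odd-residue-large : ∀ {a h d b Q r} → OddSetting a h d b Q r → b ≤ r → r ≤ 2 * b ∸ 3 →
    IsFrobeniusNumber (A a h d b) (((Q + (b ∸ 1) / 2) * h * a + 2 * b * d * Q + b * d) ⊖ (a + d))
  odd-residue-large {a} {h} {d} {b} {Q} (odd-setting β u refl refl refl coprime 1≤h bd≤ha) b≤r r≤2b-3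
    with r₀ , refl ← m≤n⇒∃[o]m+o≡n b≤r =
    subst (λ H → IsFrobeniusNumber (A a h d b) (((Q + H) * h * a + 2 * b * d * Q + b * d) ⊖ (a + d)))
      (sym (half-odd β)) $
    frobenius-at-digit-b∸1 {a} {h} {d} {b} coprime 1≤h (2 * Q) (4 + 2 * β) (Q + (2 + β))
      d ((Q + (2 + β)) * h * a + 2 * b * d * Q + b * d)
      (inj₁ (solve vs))
      (m+o≡n⇒m≤n (3 + u + 2 * β) (solve vs))
      (m+o≡n⇒m≤n (14 + r₀ + 10 * u + 6 * β + 4 * β * u) (solve vs))
      refl
      (m+o≡n⇒m≤n r₀ (solve vs))
      (≤-by-bound (∸-bound (2 * b) 3 (7 + 4 * β) (solve vs) r≤2b-3) (Q * (2 * b) + 2 * Q + 2)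
        (solve vs) (≤-reflexive (solve vs)))
      bd≤ha
      (solve vs)
    where
    vs : List ℕ
    vs = β ∷ u ∷ r₀ ∷ h ∷ d ∷ []

  odd-residue-2b-2 : ∀ {a h d b Q r} → OddSetting a h d b Q r → r ≡ 2 * b ∸ 2 →
    IsFrobeniusNumber (A a h d b) (((Q + (b ∸ 1) / 2) * h * a + 2 * b * d * Q + 2 * b * d) ⊖ (a + 3 * d))
  odd-residue-2b-2 {a} {h} {d} {b} {Q} (odd-setting β u refl refl refl coprime 1≤h _) r≡2b-2
    with refl ← ∸-solution (2 * b) 2 (8 + 4 * β) (solve (β ∷ [])) r≡2b-2 =
    subst (λ H → IsFrobeniusNumber (A a h d b) (((Q + H) * h * a + 2 * b * d * Q + 2 * b * d) ⊖ (a + 3 * d)))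
      (sym (half-odd β)) $
    frobenius-at-a∸1 {a} {h} {d} {b} coprime 1≤h (2 * Q + 1) (2 + 2 * β) (Q + (2 + β))
      (3 * d) ((Q + (2 + β)) * h * a + 2 * b * d * Q + 2 * b * d)
      (inj₂ (solve vs))
      (m+o≡n⇒m≤n (3 + u + 2 * β) (solve vs))
      (m+o≡n⇒m≤n (20 + 10 * u + 10 * β + 4 * β * u) (solve vs))
      (m+o≡n⇒m≤n 2 (solve vs))
      (≤-reflexive (solve vs))
      (solve vs)
      (solve vs)
    where
    vs : List ℕ
    vs = β ∷ u ∷ h ∷ d ∷ []

  odd-residue-2b-1 : ∀ {a h d b Q r} → OddSetting a h d b Q r → r ≡ 2 * b ∸ 1 →
    IsFrobeniusNumber (A a h d b) (((Q + (b ∸ 1) / 2) * h * a + 2 * b * d * Q + 2 * b * d) ⊖ (a + 2 * d))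
  odd-residue-2b-1 {a} {h} {d} {b} {Q} (odd-setting β u refl refl refl coprime 1≤h _) r≡2b-1
    with refl ← ∸-solution (2 * b) 1 (9 + 4 * β) (solve (β ∷ [])) r≡2b-1 =
    subst (λ H → IsFrobeniusNumber (A a h d b) (((Q + H) * h * a + 2 * b * d * Q + 2 * b * d) ⊖ (a + 2 * d)))
      (sym (half-odd β)) $
    frobenius-at-a∸1 {a} {h} {d} {b} coprime 1≤h (2 * Q + 1) (3 + 2 * β) (Q + (2 + β))
      (2 * d) ((Q + (2 + β)) * h * a + 2 * b * d * Q + 2 * b * d)
      (inj₁ (solve vs))
      (m+o≡n⇒m≤n (3 + u + 2 * β) (solve vs))
      (m+o≡n⇒m≤n (22 + 10 * u + 10 * β + 4 * β * u) (solve vs))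
      (m+o≡n⇒m≤n 1 (solve vs))
      (≤-reflexive (solve vs))
      (solve vs)
      (solve vs)
    where
    vs : List ℕ
    vs = β ∷ u ∷ h ∷ d ∷ []

open import Data.Nat using (ℕ; suc; _≤_; _∸_; _/_; _%_)
open import Data.Nat.GCD using (gcd)
open import Data.Integer using (+_; _+_; _-_; _*_)
open import Data.Product using (_×_)
open import Relation.Binary.PropositionalEquality using (_≡_)

import Data.Nat as ℕ
open import Data.Integer using (ℤ; _⊖_)
import Data.Integer.Properties as ℤ
open import Data.Integer.Tactic.RingSolver using (solve-∀)
open import Data.Product using (_,_)
open import Relation.Binary.PropositionalEquality using (refl; sym; trans; cong; cong₂; subst)
open Frobenius

pos-*₃ : ∀ x y z → + (x ℕ.* y ℕ.* z) ≡ + x * + y * + z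
pos-*₃ x y z = trans (ℤ.pos-* (x ℕ.* y) z) (cong (_* + z) (ℤ.pos-* x y))

pos-value : ∀ M h a b d Q →
  + (M ℕ.* h ℕ.* a ℕ.+ 2 ℕ.* b ℕ.* d ℕ.* Q) ≡ + M * + h * + a + + 2 * + b * + d * + Q
pos-value M h a b d Q = trans (ℤ.pos-+ (M ℕ.* h ℕ.* a) (2 ℕ.* b ℕ.* d ℕ.* Q))
  (cong₂ _+_ (pos-*₃ M h a) (trans (ℤ.pos-* (2 ℕ.* b ℕ.* d) Q) (cong (_* + Q) (pos-*₃ 2 b d))))

⊖-as-difference : ∀ {p y : ℕ} {P Y : ℤ} a → + p ≡ P → + y ≡ Y → p ⊖ (a ℕ.+ y) ≡ P - + a - Y
⊖-as-difference {p} {y} a refl refl = trans (sym (ℤ.[+m]-[+n]≡m⊖n p (a ℕ.+ y)))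
  (trans (cong (λ t → + p - t) (ℤ.pos-+ a y)) (regroup (+ p) (+ a) (+ y)))
  where
  regroup : ∀ p a y → p - (a + y) ≡ p - a - y
  regroup = solve-∀

⊖-as-difference₂ : ∀ {p x y : ℕ} {P X Y : ℤ} a → + p ≡ P → + x ≡ X → + y ≡ Y →
                   (p ℕ.+ x) ⊖ (a ℕ.+ y) ≡ P - + a + X - Y
⊖-as-difference₂ {p} {x} {y} a refl refl refl =
  trans (⊖-as-difference a (ℤ.pos-+ p x) refl) (regroup (+ p) (+ x) (+ a) (+ y))
  where
  regroup : ∀ p x a y → p + x - a - y ≡ p - a + x - y
  regroup = solve-∀

module Values (a h d b Q : ℕ) where

  value-A : ∀ M → (M ℕ.* h ℕ.* a ℕ.+ 2 ℕ.* b ℕ.* d ℕ.* Q) ⊖ (a ℕ.+ d) ≡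
            + M * + h * + a + + 2 * + b * + d * + Q - + a - + d
  value-A M = ⊖-as-difference a (pos-value M h a b d Q) refl

  value-B : ∀ M k → (M ℕ.* h ℕ.* a ℕ.+ 2 ℕ.* b ℕ.* d ℕ.* Q ℕ.+ b ℕ.* d) ⊖ (a ℕ.+ k ℕ.* d) ≡
            + M * + h * + a + + 2 * + b * + d * + Q - + a + + b * + d - + k * + d
  value-B M k = ⊖-as-difference₂ a (pos-value M h a b d Q) (ℤ.pos-* b d) (ℤ.pos-* k d)

  value-B₁ : ∀ M → (M ℕ.* h ℕ.* a ℕ.+ 2 ℕ.* b ℕ.* d ℕ.* Q ℕ.+ b ℕ.* d) ⊖ (a ℕ.+ d) ≡
             + M * + h * + a + + 2 * + b * + d * + Q - + a + + b * + d - + d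
  value-B₁ M = ⊖-as-difference₂ a (pos-value M h a b d Q) (ℤ.pos-* b d) refl

  value-C : ∀ M k → (M ℕ.* h ℕ.* a ℕ.+ 2 ℕ.* b ℕ.* d ℕ.* Q ℕ.+ 2 ℕ.* b ℕ.* d) ⊖ (a ℕ.+ k ℕ.* d) ≡
            + M * + h * + a + + 2 * + b * + d * + Q - + a + + 2 * + b * + d - + k * + d
  value-C M k = ⊖-as-difference₂ a (pos-value M h a b d Q) (pos-*₃ 2 b d) (ℤ.pos-* k d)

theorem4p6 : (a h d b : ℕ) → 1 ≤ a → 1 ≤ h → 1 ≤ d → 4 ≤ b → gcd a d ≡ 1 →
  let Q = ⌊ a / (2 Data.Nat.* b) ⌋
      r = a mod (2 Data.Nat.* b)
      g = IsFrobeniusNumber (A a h d b)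
  in ((b % 2 ≡ 0) → ⌈ (2 Data.Nat.* d) / (b ∸ 2) ⌉ ≤ h → b Data.Nat.* (b ∸ 2) ≤ a →
        (r ≤ b ∸ 3 →
           g ((+ ((Q Data.Nat.+ (b / 2)) ∸ 1)) * + h * + a + + 2 * + b * + d * + Q - + a - + d))
      × (r ≡ b ∸ 2 →
           g ((+ ((Q Data.Nat.+ (b / 2)) ∸ 1)) * + h * + a + + 2 * + b * + d * + Q - + a + + b * + d - + 3 * + d))
      × (r ≡ b ∸ 1 →
           g ((+ ((Q Data.Nat.+ (b / 2)) ∸ 1)) * + h * + a + + 2 * + b * + d * + Q - + a + + b * + d - + 2 * + d))
      × (b ≤ r → r ≤ 2 Data.Nat.* b ∸ 2 →
           g ((+ (Q Data.Nat.+ (b / 2))) * + h * + a + + 2 * + b * + d * + Q - + a + + b * + d - + d))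
      × (r ≡ 2 Data.Nat.* b ∸ 1 →
           g ((+ (Q Data.Nat.+ (b / 2))) * + h * + a + + 2 * + b * + d * + Q - + a + + 2 * + b * + d - + 2 * + d)))
   × ((b % 2 ≡ 1) → ⌈ (2 Data.Nat.* d) / (b ∸ 1) ⌉ ≤ h → b Data.Nat.* (b ∸ 1) ≤ a →
        (r ≤ b ∸ 2 →
           g ((+ (Q Data.Nat.+ ((b ∸ 1) / 2))) * + h * + a + + 2 * + b * + d * + Q - + a - + d))
      × (r ≡ b ∸ 1 →
           g ((+ (Q Data.Nat.+ ((b ∸ 1) / 2))) * + h * + a + + 2 * + b * + d * + Q - + a + + b * + d - + 2 * + d))
      × (b ≤ r → r ≤ 2 Data.Nat.* b ∸ 3 →
           g ((+ (Q Data.Nat.+ ((b ∸ 1) / 2))) * + h * + a + + 2 * + b * + d * + Q - + a + + b * + d - + d))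
      × (r ≡ 2 Data.Nat.* b ∸ 2 →
           g ((+ (Q Data.Nat.+ ((b ∸ 1) / 2))) * + h * + a + + 2 * + b * + d * + Q - + a + + 2 * + b * + d - + 3 * + d))
      × (r ≡ 2 Data.Nat.* b ∸ 1 →
           g ((+ (Q Data.Nat.+ ((b ∸ 1) / 2))) * + h * + a + + 2 * + b * + d * + Q - + a + + 2 * + b * + d - + 2 * + d)))
theorem4p6 a h d b _ 1≤h _ 4≤b coprime =
  (λ b-even h-bound a-bound → let s = even-setting-of 4≤b b-even h-bound a-bound coprime 1≤h in
      (λ r≤ → with-value (value-A ((Q ℕ.+ b / 2) ∸ 1)) (even-residue-small s r≤))
    , (λ r≡ → with-value (value-B ((Q ℕ.+ b / 2) ∸ 1) 3) (even-residue-b-2 s r≡))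
    , (λ r≡ → with-value (value-B ((Q ℕ.+ b / 2) ∸ 1) 2) (even-residue-b-1 s r≡))
    , (λ b≤r r≤ → with-value (value-B₁ (Q ℕ.+ b / 2)) (even-residue-large s b≤r r≤))
    , (λ r≡ → with-value (value-C (Q ℕ.+ b / 2) 2) (even-residue-2b-1 s r≡)))
  , (λ b-odd h-bound a-bound → let s = odd-setting-of 4≤b b-odd h-bound a-bound coprime 1≤h in
      (λ r≤ → with-value (value-A (Q ℕ.+ (b ∸ 1) / 2)) (odd-residue-small s r≤))
    , (λ r≡ → with-value (value-B (Q ℕ.+ (b ∸ 1) / 2) 2) (odd-residue-b-1 s r≡))
    , (λ b≤r r≤ → with-value (value-B₁ (Q ℕ.+ (b ∸ 1) / 2)) (odd-residue-large s b≤r r≤))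
    , (λ r≡ → with-value (value-C (Q ℕ.+ (b ∸ 1) / 2) 3) (odd-residue-2b-2 s r≡))
    , (λ r≡ → with-value (value-C (Q ℕ.+ (b ∸ 1) / 2) 2) (odd-residue-2b-1 s r≡)))
  where
  Q : ℕ
  Q = ⌊ a / (2 ℕ.* b) ⌋
  open Values a h d b Q
  with-value : ∀ {x y} → x ≡ y → IsFrobeniusNumber (A a h d b) x → IsFrobeniusNumber (A a h d b) y
  with-value = subst (IsFrobeniusNumber (A a h d b))
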